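{- For every integer $n \geq 1$, there is a bijection between the set of Catalan descending plane partitions of order $n$ and the set of Catalan DPP paths of order $n$.
   Context: A one-row descending plane partition is either the empty sequence $\emptyset$, or a finite sequence of positive integers $a_1 \geq a_2 \geq \cdots \geq a_\lambda$ (with $\lambda \geq 1$) such that $\lambda < a_1$. A Catalan descending plane partition is a one-row descending plane partition $a_1\, a_2 \cdots a_\lambda$ such that $a_j \leq a_1 - j + 1$ for every $j = 1, \ldots, \lambda$ (the empty sequence included). It is of order $n$ if its largest part is at most $n$ (the empty one is of every order $n$). A Catalan DPP path of order $n$ is a finite (possibly empty) sequence of entries in $\{ -1, 1\}$ containing at most $n-1$ entries equal to $1$, such that every left-to-right partial sum is nonnegative and, if the sequence is nonempty, its total sum is strictly greater than $0$. -}

module Defs where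

open import Data.Nat using (ℕ; zero; suc; _+_)
import Data.Nat
import Data.Integer
open import Data.Integer using (ℤ; +_; -[1+_]) renaming (_+_ to _+ℤ_)
open import Data.List using (List; []; _∷_; length)
open import Data.Bool using (Bool; true; false; _∧_; _∨_; T)
open import Data.Product using (Σ)

positive-decreasing : List ℕ → Bool
positive-decreasing [] = true
positive-decreasing (a ∷ []) = 1 Data.Nat.≤ᵇ a
positive-decreasing (a ∷ b ∷ rest) = (b Data.Nat.≤ᵇ a) ∧ positive-decreasing (b ∷ rest)

isOneRowDPP : List ℕ → Bool
isOneRowDPP [] = true
isOneRowDPP (a ∷ rest) = positive-decreasing (a ∷ rest) ∧ (length (a ∷ rest) Data.Nat.<ᵇ a)

-- a_j ≤ a_1 - j + 1 for every j; checked as: the j-th entry (1-based) plus (j - 1) ≤ a_1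
catalanBound : ℕ → ℕ → List ℕ → Bool
catalanBound a1 k [] = true
catalanBound a1 k (b ∷ rest) = ((b + k) Data.Nat.≤ᵇ a1) ∧ catalanBound a1 (suc k) rest

isCatalanDPP : List ℕ → Bool
isCatalanDPP [] = true
isCatalanDPP (a ∷ rest) = isOneRowDPP (a ∷ rest) ∧ catalanBound a 0 (a ∷ rest)

-- all parts ≤ n (equivalently the largest part ≤ n, as the sequence is decreasing;
-- the empty sequence is of every order)
allAtMost : ℕ → List ℕ → Bool
allAtMost n [] = true
allAtMost n (a ∷ rest) = (a Data.Nat.≤ᵇ n) ∧ allAtMost n rest

CatalanDPP : ℕ → Set
CatalanDPP n = Σ (List ℕ) (λ xs → T (isCatalanDPP xs ∧ allAtMost n xs))

isStep : ℤ → Bool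
isStep (+ 1) = true
isStep -[1+ 0 ] = true
isStep _ = false

allSteps : List ℤ → Bool
allSteps [] = true
allSteps (x ∷ xs) = isStep x ∧ allSteps xs

countOnes : List ℤ → ℕ
countOnes [] = 0
countOnes (+ 1 ∷ xs) = suc (countOnes xs)
countOnes (_ ∷ xs) = countOnes xs

prefixNonneg : ℤ → List ℤ → Bool
prefixNonneg s [] = true
prefixNonneg s (x ∷ xs) = (+ 0 Data.Integer.≤ᵇ (s +ℤ x)) ∧ prefixNonneg (s +ℤ x) xs

total : List ℤ → ℤ
total [] = + 0
total (x ∷ xs) = x +ℤ total xs

positiveTotalIfNonempty : List ℤ → Bool
positiveTotalIfNonempty [] = true
positiveTotalIfNonempty (x ∷ xs) = + 1 Data.Integer.≤ᵇ total (x ∷ xs)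

-- at most n - 1 entries equal to 1, i.e. countOnes + 1 ≤ n
isCatalanDPPPath : ℕ → List ℤ → Bool
isCatalanDPPPath n xs =
  allSteps xs ∧ (suc (countOnes xs) Data.Nat.≤ᵇ n) ∧ prefixNonneg (+ 0) xs ∧ positiveTotalIfNonempty xs

CatalanDPPPath : ℕ → Set
CatalanDPPPath n = Σ (List ℤ) (λ xs → T (isCatalanDPPPath n xs))

-- A Catalan DPP a₁ ≥ a₂ ≥ ⋯ ≥ a_λ is sent to the path U^(a₁−a₂) D U^(a₂−a₃) D ⋯ U^(a_(λ−1)−a_λ) D U^(a_λ−1),
-- where U = 1 and D = −1. Conversely a path is read with a current value that starts at a₁ = 1 + #U,
-- drops by one at each U and is recorded as the next part at each D. The height just after the
-- (j−1)-th D is a₁ − a_j − (j − 1), which is nonnegative exactly when a_j ≤ a₁ − j + 1; the total is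
-- (a₁ − 1) − (λ − 1), positive exactly when λ < a₁; and there are a₁ − 1 ≤ n − 1 up-steps exactly when a₁ ≤ n.
module Submission where

open import Defs
open import Data.Nat using (ℕ; _≥_)
open import Function.Bundles using (_⤖_)

open import Data.Bool using (Bool; _∧_; T)
open import Data.Bool.Properties using (T-∧; T-irrelevant)
open import Data.Empty using (⊥-elim)
open import Data.Integer using (ℤ; +_; -[1+_]; _⊖_) renaming (_+_ to _+ℤ_; _≤ᵇ_ to _≤ᵇℤ_)
open import Data.Integer.Properties using ([1+m]⊖[1+n]≡m⊖n; distribʳ-⊖-+-pos; distribʳ-⊖-+-neg)
open import Data.List using (List; []; _∷_; length)
open import Data.Nat using (zero; suc; pred; _+_; _≤_; _<_; _∸_; _≤ᵇ_; s≤s; z≤n; z<s)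
open import Data.Nat.Properties
  using (≤-refl; ≤-trans; ≤-pred; ≤-reflexive; n≤1+n; pred[n]≤n; suc[m]≤n⇒m≤pred[n]; m≤n+m;
         <-irrefl; ≤⇒≤ᵇ; ≤ᵇ⇒≤; <⇒<ᵇ; <ᵇ⇒<; +-identityʳ; +-comm; suc-injective;
         +-∸-assoc; n∸n≡0; 0∸n≡0; m∸n+n≡m; m∸[m∸n]≡n)
open import Data.Nat.Tactic.RingSolver using (solve-∀)
open import Data.Product using (Σ; _,_; _×_; proj₁; proj₂)
open import Data.Product.Properties using (Σ-≡,≡→≡)
open import Function.Bundles using (Equivalence; mk↔ₛ′)
open import Function.Properties.Inverse using (↔⇒⤖)
open import Relation.Binary.PropositionalEquality
  using (_≡_; refl; sym; trans; cong; subst; subst₂; module ≡-Reasoning)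

∧-intro : ∀ x {y} → T x → T y → T (x ∧ y)
∧-intro x p q = Equivalence.from (T-∧ {x}) (p , q)

∧-elim : ∀ x {y} → T (x ∧ y) → T x × T y
∧-elim x = Equivalence.to (T-∧ {x})

pattern up   = + 1
pattern down = -[1+ 0 ]

data Steps : List ℤ → Set where
  []     : Steps []
  up∷_   : ∀ {xs} → Steps xs → Steps (up ∷ xs)
  down∷_ : ∀ {xs} → Steps xs → Steps (down ∷ xs)

allSteps⇒Steps : ∀ xs → T (allSteps xs) → Steps xs
allSteps⇒Steps []                    _  = []
allSteps⇒Steps (up ∷ xs)             ok = up∷ allSteps⇒Steps xs ok
allSteps⇒Steps (down ∷ xs)           ok = down∷ allSteps⇒Steps xs ok
allSteps⇒Steps (+ 0 ∷ _)             ()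
allSteps⇒Steps (+ suc (suc _) ∷ _)   ()
allSteps⇒Steps (-[1+ suc _ ] ∷ _)    ()

Steps⇒allSteps : ∀ {xs} → Steps xs → T (allSteps xs)
Steps⇒allSteps []          = _
Steps⇒allSteps (up∷ st)    = Steps⇒allSteps st
Steps⇒allSteps (down∷ st)  = Steps⇒allSteps st

countDowns : List ℤ → ℕ
countDowns []          = 0
countDowns (down ∷ xs) = suc (countDowns xs)
countDowns (_ ∷ xs)    = countDowns xs

ups : ℕ → List ℤ → List ℤ
ups zero    xs = xs
ups (suc k) xs = up ∷ ups k xs

ups-Steps : ∀ k {xs} → Steps xs → Steps (ups k xs)
ups-Steps zero    st = st
ups-Steps (suc k) st = up∷ ups-Steps k st

countOnes-ups : ∀ k xs → countOnes (ups k xs) ≡ k + countOnes xs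
countOnes-ups zero    xs = refl
countOnes-ups (suc k) xs = cong suc (countOnes-ups k xs)

countDowns-ups : ∀ k xs → countDowns (ups k xs) ≡ countDowns xs
countDowns-ups zero    xs = refl
countDowns-ups (suc k) xs = countDowns-ups k xs

prefixNonneg-ups : ∀ k {h xs} → T (prefixNonneg (+ (k + h)) xs) → T (prefixNonneg (+ h) (ups k xs))
prefixNonneg-ups zero        ok = ok
prefixNonneg-ups (suc k) {h} {xs} ok =
  prefixNonneg-ups k (subst (λ s → T (prefixNonneg (+ s) xs)) (sym (k+[h+1]≡1+k+h k h)) ok)
  where
  k+[h+1]≡1+k+h : ∀ k h → k + (h + 1) ≡ suc (k + h)
  k+[h+1]≡1+k+h = solve-∀

data Partition≤ : ℕ → List ℕ → Set where
  []  : ∀ {c} → Partition≤ c []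
  _∷_ : ∀ {c t ts} → 1 ≤ t × t ≤ c → Partition≤ t ts → Partition≤ c (t ∷ ts)

Partition≤-weaken : ∀ {c d ts} → c ≤ d → Partition≤ c ts → Partition≤ d ts
Partition≤-weaken c≤d []                    = []
Partition≤-weaken c≤d ((1≤t , t≤c) ∷ ps)   = (1≤t , ≤-trans t≤c c≤d) ∷ ps

positive-decreasing⇒Partition≤ : ∀ a ts → T (positive-decreasing (a ∷ ts)) → Partition≤ a (a ∷ ts)
positive-decreasing⇒Partition≤ a []       1≤a = (≤ᵇ⇒≤ 1 a 1≤a , ≤-refl) ∷ []
positive-decreasing⇒Partition≤ a (b ∷ ts) ok
  with b≤a , rest ← ∧-elim (b ≤ᵇ a) ok
  with (1≤b , _) ∷ ps ← positive-decreasing⇒Partition≤ b ts rest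
  = (≤-trans 1≤b (≤ᵇ⇒≤ b a b≤a) , ≤-refl) ∷ (1≤b , ≤ᵇ⇒≤ b a b≤a) ∷ ps

Partition≤⇒positive-decreasing : ∀ {c ts} → Partition≤ c ts → T (positive-decreasing ts)
Partition≤⇒positive-decreasing []                                 = _
Partition≤⇒positive-decreasing ((1≤t , _) ∷ [])                   = ≤⇒≤ᵇ 1≤t
Partition≤⇒positive-decreasing {ts = t ∷ u ∷ _} (_ ∷ ps@((_ , u≤t) ∷ _)) =
  ∧-intro (u ≤ᵇ t) (≤⇒≤ᵇ u≤t) (Partition≤⇒positive-decreasing ps)

Partition≤⇒allAtMost : ∀ {c n ts} → c ≤ n → Partition≤ c ts → T (allAtMost n ts)
Partition≤⇒allAtMost c≤n [] = _
Partition≤⇒allAtMost {n = n} {t ∷ _} c≤n ((_ , t≤c) ∷ ps) =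
  ∧-intro (t ≤ᵇ n) (≤⇒≤ᵇ t≤n) (Partition≤⇒allAtMost t≤n ps)
  where
  t≤n : t ≤ n
  t≤n = ≤-trans t≤c c≤n

encode : ℕ → List ℕ → List ℤ
encode c []       = ups (pred c) []
encode c (t ∷ ts) = ups (c ∸ t) (down ∷ encode t ts)

encode-Steps : ∀ c ts → Steps (encode c ts)
encode-Steps c []       = ups-Steps (pred c) []
encode-Steps c (t ∷ ts) = ups-Steps (c ∸ t) (down∷ encode-Steps t ts)

countDowns-encode : ∀ c ts → countDowns (encode c ts) ≡ length ts
countDowns-encode c []       = countDowns-ups (pred c) []
countDowns-encode c (t ∷ ts) =
  trans (countDowns-ups (c ∸ t) (down ∷ encode t ts)) (cong suc (countDowns-encode t ts))

countOnes-encode : ∀ {c ts} → Partition≤ c ts → countOnes (encode c ts) ≡ pred c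
countOnes-encode {c} [] = trans (countOnes-ups (pred c) []) (+-identityʳ (pred c))
countOnes-encode {suc c} {suc t ∷ ts} ((_ , s≤s t≤c) ∷ ps) = begin
  countOnes (ups (c ∸ t) (down ∷ encode (suc t) ts)) ≡⟨ countOnes-ups (c ∸ t) _ ⟩
  c ∸ t + countOnes (encode (suc t) ts)                ≡⟨ cong (_+_ (c ∸ t)) (countOnes-encode ps) ⟩
  c ∸ t + t                                            ≡⟨ m∸n+n≡m t≤c ⟩
  c                                                    ∎
  where open ≡-Reasoning

-- h is the height reached, c the current value and j the number of parts read so far (a₁ included):
-- after a − c up-steps and j − 1 down-steps, h + j + c = a + 1.
encode-prefixNonneg : ∀ {a c h j ts} → Partition≤ c ts → T (catalanBound a j ts) →
                      h + (j + c) ≡ suc a → T (prefixNonneg (+ h) (encode c ts))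
encode-prefixNonneg {c = c} [] _ _ = prefixNonneg-ups (pred c) _
encode-prefixNonneg {a} {c} {h} {j} {t ∷ ts} ((_ , t≤c) ∷ ps) bound h+j+c≡1+a
  with t+j≤a , bound′ ← ∧-elim (t + j ≤ᵇ a) bound
  = prefixNonneg-ups (c ∸ t) (after-ups (c ∸ t + h) height)
  where
  height : c ∸ t + h + (t + j) ≡ suc a
  height = begin
    c ∸ t + h + (t + j)   ≡⟨ rearrange (c ∸ t) h t j ⟩
    h + (j + (c ∸ t + t)) ≡⟨ cong (λ m → h + (j + m)) (m∸n+n≡m t≤c) ⟩
    h + (j + c)           ≡⟨ h+j+c≡1+a ⟩
    suc a                 ∎
    where
    open ≡-Reasoning
    rearrange : ∀ k h t j → k + h + (t + j) ≡ h + (j + (k + t))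
    rearrange = solve-∀

  after-ups : ∀ s → s + (t + j) ≡ suc a → T (prefixNonneg (+ s) (down ∷ encode t ts))
  after-ups zero    t+j≡1+a = ⊥-elim (<-irrefl refl (subst (_≤ a) t+j≡1+a (≤ᵇ⇒≤ (t + j) a t+j≤a)))
  after-ups (suc s) 1+s+t+j≡1+a =
    encode-prefixNonneg ps bound′ (trans (shift s t j) 1+s+t+j≡1+a)
    where
    shift : ∀ s t j → s + (suc j + t) ≡ suc s + (t + j)
    shift = solve-∀

decode : ℕ → List ℤ → List ℕ
decode c []          = []
decode c (up ∷ xs)   = decode (pred c) xs
decode c (down ∷ xs) = c ∷ decode c xs
decode c (_ ∷ xs)    = decode c xs

length-decode : ∀ {c xs} → Steps xs → length (decode c xs) ≡ countDowns xs
length-decode []         = refl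
length-decode (up∷ st)   = length-decode st
length-decode (down∷ st) = cong suc (length-decode st)

decode-Partition≤ : ∀ {c xs} → Steps xs → countOnes xs < c → Partition≤ c (decode c xs)
decode-Partition≤         []         _         = []
decode-Partition≤ {suc c} (up∷ st)   (s≤s k<c) = Partition≤-weaken (n≤1+n c) (decode-Partition≤ st k<c)
decode-Partition≤ {suc c} (down∷ st) k<c       = (s≤s z≤n , ≤-refl) ∷ decode-Partition≤ st k<c

decode-catalanBound : ∀ {a c h j xs} → Steps xs → countOnes xs < c → T (prefixNonneg (+ h) xs) →
                      h + (j + c) ≡ suc a → T (catalanBound a j (decode c xs))
decode-catalanBound [] _ _ _ = _
decode-catalanBound {a} {suc c} {h} {j} (up∷ st) (s≤s k<c) ok h+j+c≡1+a =
  decode-catalanBound st k<c ok (trans (shift h j c) h+j+c≡1+a)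
  where
  shift : ∀ h j c → h + 1 + (j + c) ≡ h + (j + suc c)
  shift = solve-∀
decode-catalanBound {h = zero} (down∷ st) _ ()
decode-catalanBound {a} {c} {suc h} {j} (down∷ st) k<c ok 1+h+j+c≡1+a =
  ∧-intro (c + j ≤ᵇ a) (≤⇒≤ᵇ c+j≤a) (decode-catalanBound st k<c ok (trans (shift h j c) 1+h+j+c≡1+a))
  where
  c+j≤a : c + j ≤ a
  c+j≤a = subst₂ _≤_ (+-comm j c) (suc-injective 1+h+j+c≡1+a) (m≤n+m (j + c) h)
  shift : ∀ h j c → h + (suc j + c) ≡ suc h + (j + c)
  shift = solve-∀

decode-ups : ∀ k c xs → decode c (ups k xs) ≡ decode (c ∸ k) xs
decode-ups zero    c       xs = refl
decode-ups (suc k) (suc c) xs = decode-ups k c xs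
decode-ups (suc k) zero    xs = trans (decode-ups k zero xs) (cong (λ c → decode c xs) (0∸n≡0 k))

decode-encode : ∀ {c ts} → Partition≤ c ts → decode c (encode c ts) ≡ ts
decode-encode {c} [] = decode-ups (pred c) c []
decode-encode {c} {t ∷ ts} ((_ , t≤c) ∷ ps) = begin
  decode c (ups (c ∸ t) (down ∷ encode t ts)) ≡⟨ decode-ups (c ∸ t) c _ ⟩
  decode (c ∸ (c ∸ t)) (down ∷ encode t ts)   ≡⟨ cong (λ c′ → decode c′ (down ∷ encode t ts)) (m∸[m∸n]≡n t≤c) ⟩
  t ∷ decode t (encode t ts)                  ≡⟨ cong (t ∷_) (decode-encode ps) ⟩
  t ∷ ts                                      ∎
  where open ≡-Reasoning

encode-suc : ∀ {c ts} → Partition≤ (suc c) ts → encode (suc (suc c)) ts ≡ up ∷ encode (suc c) ts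
encode-suc []                            = refl
encode-suc {c} {t ∷ ts} ((_ , t≤1+c) ∷ _) =
  cong (λ k → ups k (down ∷ encode t ts)) (+-∸-assoc 1 t≤1+c)

encode-decode : ∀ {xs} → Steps xs → encode (suc (countOnes xs)) (decode (suc (countOnes xs)) xs) ≡ xs
encode-decode [] = refl
encode-decode {up ∷ xs} (up∷ st) = begin
  encode (suc (suc k)) (decode (suc k) xs) ≡⟨ encode-suc (decode-Partition≤ st ≤-refl) ⟩
  up ∷ encode (suc k) (decode (suc k) xs)  ≡⟨ cong (up ∷_) (encode-decode st) ⟩
  up ∷ xs                                  ∎
  where
  open ≡-Reasoning
  k : ℕ
  k = countOnes xs
encode-decode {down ∷ xs} (down∷ st) = begin
  ups (c ∸ c) (down ∷ encode c (decode c xs)) ≡⟨ cong (λ m → ups m (down ∷ encode c (decode c xs))) (n∸n≡0 c) ⟩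
  down ∷ encode c (decode c xs)              ≡⟨ cong (down ∷_) (encode-decode st) ⟩
  down ∷ xs                                  ∎
  where
  open ≡-Reasoning
  c : ℕ
  c = suc (countOnes xs)

total≡ones⊖downs : ∀ {xs} → Steps xs → total xs ≡ countOnes xs ⊖ countDowns xs
total≡ones⊖downs [] = refl
total≡ones⊖downs {up ∷ xs} (up∷ st) = trans (cong (up +ℤ_) (total≡ones⊖downs st))
  (distribʳ-⊖-+-pos 1 (countOnes xs) (countDowns xs))
total≡ones⊖downs {down ∷ xs} (down∷ st) = trans (cong (down +ℤ_) (total≡ones⊖downs st))
  (distribʳ-⊖-+-neg 0 (countOnes xs) (countDowns xs))

⊖-positive⇒> : ∀ m n → T (+ 1 ≤ᵇℤ m ⊖ n) → n < m
⊖-positive⇒> zero    zero    ()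
⊖-positive⇒> zero    (suc n) ()
⊖-positive⇒> (suc m) zero    _   = z<s
⊖-positive⇒> (suc m) (suc n) pos =
  s≤s (⊖-positive⇒> m n (subst (λ i → T (+ 1 ≤ᵇℤ i)) ([1+m]⊖[1+n]≡m⊖n m n) pos))

>⇒⊖-positive : ∀ {m n} → n < m → T (+ 1 ≤ᵇℤ m ⊖ n)
>⇒⊖-positive {suc m} {zero}  _         = _
>⇒⊖-positive {suc m} {suc n} (s≤s n<m) =
  subst (λ i → T (+ 1 ≤ᵇℤ i)) (sym ([1+m]⊖[1+n]≡m⊖n m n)) (>⇒⊖-positive n<m)

record NonemptyCatalanDPP (n a : ℕ) (ts : List ℕ) : Set where
  constructor catalanDPP
  field
    parts   : Partition≤ (pred a) ts
    short   : 2 + length ts ≤ a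
    catalan : T (catalanBound a 1 ts)
    a≤n     : a ≤ n

-- The conditions on xs for up ∷ xs to be a Catalan DPP path of order n.
record NonemptyCatalanDPPPath (n : ℕ) (xs : List ℤ) : Set where
  constructor catalanDPPPath
  field
    steps      : Steps xs
    ones≤n     : 2 + countOnes xs ≤ n
    prefix     : T (prefixNonneg (+ 1) xs)
    downs≤ones : countDowns xs ≤ countOnes xs

Partition≤-pred : ∀ {a ts} → Partition≤ a ts → T (catalanBound a 1 ts) → Partition≤ (pred a) ts
Partition≤-pred [] _ = []
Partition≤-pred {a} {t ∷ _} ((1≤t , _) ∷ ps) bound = (1≤t , suc[m]≤n⇒m≤pred[n] 1+t≤a) ∷ ps
  where
  1+t≤a : suc t ≤ a
  1+t≤a = subst (_≤ a) (+-comm t 1) (≤ᵇ⇒≤ (t + 1) a (proj₁ (∧-elim (t + 1 ≤ᵇ a) bound)))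

isCatalanDPP⇒ : ∀ {n} a ts → T (isCatalanDPP (a ∷ ts) ∧ allAtMost n (a ∷ ts)) → NonemptyCatalanDPP n a ts
isCatalanDPP⇒ {n} a ts ok
  with dpp , atMost ← ∧-elim (isCatalanDPP (a ∷ ts)) ok
  with row , bound  ← ∧-elim (isOneRowDPP (a ∷ ts)) dpp
  with decreasing , short ← ∧-elim (positive-decreasing (a ∷ ts)) row
  with _ ∷ parts ← positive-decreasing⇒Partition≤ a ts decreasing
  = catalanDPP (Partition≤-pred parts catalan) (<ᵇ⇒< _ a short) catalan
               (≤ᵇ⇒≤ a n (proj₁ (∧-elim (a ≤ᵇ n) atMost)))
  where
  catalan : T (catalanBound a 1 ts)
  catalan = proj₂ (∧-elim (a + 0 ≤ᵇ a) bound)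

⇒isCatalanDPP : ∀ {n a ts} → NonemptyCatalanDPP n a ts → T (isCatalanDPP (a ∷ ts) ∧ allAtMost n (a ∷ ts))
⇒isCatalanDPP {n} {a} {ts} (catalanDPP parts short catalan a≤n) =
  ∧-intro (isCatalanDPP (a ∷ ts))
    (∧-intro (isOneRowDPP (a ∷ ts))
      (∧-intro (positive-decreasing (a ∷ ts))
        (Partition≤⇒positive-decreasing ((≤-trans (s≤s z≤n) short , ≤-refl) ∷ parts′)) (<⇒<ᵇ short))
      (∧-intro (a + 0 ≤ᵇ a) (≤⇒≤ᵇ (≤-reflexive (+-identityʳ a))) catalan))
    (∧-intro (a ≤ᵇ n) (≤⇒≤ᵇ a≤n) (Partition≤⇒allAtMost a≤n parts′))
  where
  parts′ : Partition≤ a ts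
  parts′ = Partition≤-weaken pred[n]≤n parts

isCatalanDPPPath⇒ : ∀ {n} x xs → T (isCatalanDPPPath n (x ∷ xs)) → x ≡ up × NonemptyCatalanDPPPath n xs
isCatalanDPPPath⇒ {n} up xs ok
  with steps , ok₁  ← ∧-elim (allSteps xs) ok
  with ones≤n , ok₂ ← ∧-elim (2 + countOnes xs ≤ᵇ n) ok₁
  with prefix , pos ← ∧-elim (prefixNonneg (+ 1) xs) ok₂
  = refl , catalanDPPPath (allSteps⇒Steps xs steps) (≤ᵇ⇒≤ _ n ones≤n) prefix (≤-pred downs<1+ones)
  where
  downs<1+ones : countDowns xs < suc (countOnes xs)
  downs<1+ones = ⊖-positive⇒> _ _
    (subst (λ i → T (+ 1 ≤ᵇℤ i)) (total≡ones⊖downs (up∷ allSteps⇒Steps xs steps)) pos)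
isCatalanDPPPath⇒ {n} down xs ok
  with _ , ok₁ ← ∧-elim (allSteps xs) ok
  with _ , () ← ∧-elim (1 + countOnes xs ≤ᵇ n) ok₁
isCatalanDPPPath⇒ (+ 0)            _ ()
isCatalanDPPPath⇒ (+ suc (suc _))  _ ()
isCatalanDPPPath⇒ -[1+ suc _ ]     _ ()

⇒isCatalanDPPPath : ∀ {n xs} → NonemptyCatalanDPPPath n xs → T (isCatalanDPPPath n (up ∷ xs))
⇒isCatalanDPPPath {n} {xs} (catalanDPPPath steps ones≤n prefix downs≤ones) =
  ∧-intro (allSteps xs) (Steps⇒allSteps steps)
    (∧-intro (2 + countOnes xs ≤ᵇ n) (≤⇒≤ᵇ ones≤n)
      (∧-intro (prefixNonneg (+ 1) xs) prefix
        (subst (λ i → T (+ 1 ≤ᵇℤ i)) (sym (total≡ones⊖downs (up∷ steps))) (>⇒⊖-positive (s≤s downs≤ones)))))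

dppToPath : List ℕ → List ℤ
dppToPath []       = []
dppToPath (a ∷ ts) = up ∷ encode (pred a) ts

-- Every nonempty path starts with an up-step, so its first entry carries no information.
pathToDPP : List ℤ → List ℕ
pathToDPP []       = []
pathToDPP (_ ∷ xs) = 2 + countOnes xs ∷ decode (suc (countOnes xs)) xs

dppToPath-valid : ∀ {n a ts} → NonemptyCatalanDPP n a ts → NonemptyCatalanDPPPath n (encode (pred a) ts)
dppToPath-valid {n} {suc (suc b)} {ts} (catalanDPP parts (s≤s (s≤s length≤b)) catalan a≤n) =
  catalanDPPPath (encode-Steps (suc b) ts)
    (subst (λ k → 2 + k ≤ n) (sym (countOnes-encode parts)) a≤n)
    (encode-prefixNonneg parts catalan refl)
    (subst₂ _≤_ (sym (countDowns-encode (suc b) ts)) (sym (countOnes-encode parts)) length≤b)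

pathToDPP-valid : ∀ {n xs} → NonemptyCatalanDPPPath n xs →
                  NonemptyCatalanDPP n (2 + countOnes xs) (decode (suc (countOnes xs)) xs)
pathToDPP-valid {xs = xs} (catalanDPPPath steps ones≤n prefix downs≤ones) =
  catalanDPP (decode-Partition≤ steps ≤-refl)
    (s≤s (s≤s (subst (_≤ countOnes xs) (sym (length-decode steps)) downs≤ones)))
    (decode-catalanBound steps ≤-refl prefix refl)
    ones≤n

pathToDPP∘dppToPath : ∀ {n a ts} → NonemptyCatalanDPP n a ts → pathToDPP (dppToPath (a ∷ ts)) ≡ a ∷ ts
pathToDPP∘dppToPath {a = suc (suc b)} (catalanDPP parts (s≤s (s≤s _)) _ _)
  rewrite countOnes-encode parts = cong (suc (suc b) ∷_) (decode-encode parts)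

dppToPath∘pathToDPP : ∀ {xs} → Steps xs → dppToPath (pathToDPP (up ∷ xs)) ≡ up ∷ xs
dppToPath∘pathToDPP steps = cong (up ∷_) (encode-decode steps)

module _ {n : ℕ} where

  toPath : n ≥ 1 → CatalanDPP n → CatalanDPPPath n
  toPath n≥1 ([] , _)      = [] , ∧-intro (1 ≤ᵇ n) (≤⇒≤ᵇ n≥1) _
  toPath _   (a ∷ ts , ok) = dppToPath (a ∷ ts) , ⇒isCatalanDPPPath (dppToPath-valid (isCatalanDPP⇒ a ts ok))

  toDPP : CatalanDPPPath n → CatalanDPP n
  toDPP ([] , _)      = [] , _
  toDPP (x ∷ xs , ok) = pathToDPP (x ∷ xs) , ⇒isCatalanDPP (pathToDPP-valid (proj₂ (isCatalanDPPPath⇒ x xs ok)))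

Σ-T-≡ : ∀ {A : Set} {P : A → Bool} {p q : Σ A (λ x → T (P x))} → proj₁ p ≡ proj₁ q → p ≡ q
Σ-T-≡ eq = Σ-≡,≡→≡ (eq , T-irrelevant _ _)

lemma3p4 : (n : ℕ) → n ≥ 1 → CatalanDPP n ⤖ CatalanDPPPath n
lemma3p4 n n≥1 = ↔⇒⤖ (mk↔ₛ′ (toPath n≥1) toDPP toPath∘toDPP toDPP∘toPath)
  where
  toPath∘toDPP : ∀ p → toPath n≥1 (toDPP p) ≡ p
  toPath∘toDPP ([] , _) = Σ-T-≡ refl
  toPath∘toDPP (x ∷ xs , ok) with isCatalanDPPPath⇒ {n} x xs ok
  ... | refl , path = Σ-T-≡ (dppToPath∘pathToDPP (NonemptyCatalanDPPPath.steps path))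

  toDPP∘toPath : ∀ d → toDPP (toPath n≥1 d) ≡ d
  toDPP∘toPath ([] , _)      = Σ-T-≡ refl
  toDPP∘toPath (a ∷ ts , ok) = Σ-T-≡ (pathToDPP∘dppToPath (isCatalanDPP⇒ a ts ok))
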